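{- If $G$ is a graph of girth at least $7$, then $\chi_{\mu_2}(G)\ge \gamma(G)$.
   Context: All graphs are finite, simple and undirected. The girth of $G$ is the length of a shortest cycle ($\infty$ for forests). A $u,v$-geodesic is a shortest $u,v$-path. A set $M\subseteq V(G)$ is a $2$-distance mutual-visibility set if for every two distinct $u,v\in M$ there is a $u,v$-geodesic of length at most $2$ none of whose internal vertices lies in $M$. $\chi_{\mu_2}(G)$ is the minimum number of parts in a partition of $V(G)$ into $2$-distance mutual-visibility sets. $\gamma(G)$ is the domination number of $G$. -}

module Defs where

open import Level using (0ℓ)
open import Data.Nat using (ℕ; zero; suc; _≤_)
open import Data.Fin using (Fin; zero; suc; inject₁; fromℕ)
open import Data.Fin.Subset using (Subset; _∈_; _∉_; ∣_∣)
open import Data.Product using (Σ; ∃; _×_; _,_)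
open import Data.Sum using (_⊎_)
open import Relation.Nullary using (¬_)
open import Relation.Binary.PropositionalEquality using (_≡_)
open import Function.Definitions using (Injective)

record Graph (n : ℕ) : Set₁ where
  field
    Adj   : Fin n → Fin n → Set
    sym   : ∀ {u v} → Adj u v → Adj v u
    irrefl : ∀ {u} → ¬ Adj u u
open Graph public

module _ {n : ℕ} (G : Graph n) where

  -- A cycle of length k = suc m (k ≥ 3): distinct vertices f 0, …, f m
  -- with f i ~ f (i+1) and f m ~ f 0.
  IsCycle : (m : ℕ) → (Fin (suc m) → Fin n) → Set
  IsCycle m f = 3 ≤ suc m
              × Injective _≡_ _≡_ f
              × (∀ (i : Fin m) → Adj G (f (inject₁ i)) (f (suc i)))
              × Adj G (f (fromℕ m)) (f zero)

  GirthAtLeast7 : Set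
  GirthAtLeast7 = ∀ (m : ℕ) (f : Fin (suc m) → Fin n) → IsCycle m f → 7 ≤ suc m

  -- Length-1 paths are edges (no internal vertex); a length-2 path u–w–v is a
  -- geodesic iff u ≠ v and u,v are non-adjacent; its internal vertex is w.
  ShortGeodesicAvoiding : Subset n → Fin n → Fin n → Set
  ShortGeodesicAvoiding M u v =
      Adj G u v
    ⊎ (¬ (u ≡ v) × ¬ Adj G u v × ∃ λ w → Adj G u w × Adj G w v × w ∉ M)

  Is2DMV : Subset n → Set
  Is2DMV M = ∀ u v → u ∈ M → v ∈ M → ¬ (u ≡ v) → ShortGeodesicAvoiding M u v

  _⁻¹[_] : ∀ {k} → (Fin n → Fin k) → Fin k → Subset n
  (c ⁻¹[ i ]) = Data.Vec.tabulate (λ v → isYes (c v Data.Fin.≟ i))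
    where open import Data.Vec using (tabulate)
          open import Relation.Nullary.Decidable using (isYes)
          import Data.Fin

  -- V(G) can be partitioned into (at most) k 2-distance mutual-visibility sets,
  -- i.e. χ_μ2(G) ≤ k.  (A colouring with k colours; empty classes allowed.)
  Has2DMVPartition : ℕ → Set
  Has2DMVPartition k = Σ (Fin n → Fin k) λ c → ∀ i → Is2DMV (c ⁻¹[ i ])

  IsDominating : Subset n → Set
  IsDominating D = ∀ v → v ∈ D ⊎ (∃ λ u → u ∈ D × Adj G u v)

  DominationAtMost : ℕ → Set
  DominationAtMost k = Σ (Subset n) λ D → IsDominating D × ∣ D ∣ ≤ k

{-# OPTIONS --safe #-}
-- A 2-distance mutual-visibility set M is a 2-clique: its vertices are
-- pairwise at distance at most 2.  In a graph of girth at least 7 every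
-- 2-clique lies in a closed neighbourhood N[x]: if u, v₀ ∈ M are not adjacent,
-- they have a common neighbour w, and any other v ∈ M outside N[w] would close
-- a cycle of length at most 6 through u, v₀ and w.  Choosing one such centre
-- per colour class gives a dominating set with at most one vertex per colour.
module Submission where

open import Defs
open import Data.Nat using (ℕ; zero; suc; _≤_; _+_; z≤n; s≤s)
open import Data.Nat.Properties
  using (≤-trans; ≤-reflexive; +-suc; +-monoʳ-≤; +-mono-≤; n≤1+n; <⇒≱; _≤?_; _<?_)
open import Data.Fin using (Fin; zero; suc; inject₁; fromℕ; _≟_)
open import Data.Fin.Properties using (∀-cons; ∃-there)
open import Data.Fin.Subset
  using (Subset; _∈_; _⊆_; _∪_; ⁅_⁆; ⋃; ∣_∣; Empty; inside; outside)
  renaming (⊥ to ∅)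
open import Data.Fin.Subset.Properties
  using (_∈?_; nonempty?; p⊆p∪q; q⊆p∪q; x∈⁅x⁆; ∣⁅x⁆∣≡1; ∣⊥∣≡0)
open import Data.List using (List; []; _∷_; length; tabulate)
open import Data.List.Properties using (length-tabulate)
open import Data.List.Membership.Propositional using () renaming (_∈_ to _∈ₗ_)
open import Data.List.Membership.Propositional.Properties using (∈-tabulate⁺)
open import Data.List.Relation.Unary.All using (All; []; _∷_)
open import Data.List.Relation.Unary.All.Properties using (tabulate⁺)
open import Data.List.Relation.Unary.Any using (here; there)
open import Data.Vec using (Vec; []; _∷_; lookup; head; last)
open import Data.Vec.Properties using (lookup⇒[]=; lookup∘tabulate)
open import Data.Vec.Relation.Unary.All using ([]; _∷_)
open import Data.Vec.Relation.Unary.AllPairs using ([]; _∷_)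
open import Data.Vec.Relation.Unary.Linked using (Linked; [-]; _∷_)
open import Data.Vec.Relation.Unary.Unique.Propositional using (Unique)
open import Data.Vec.Relation.Unary.Unique.Propositional.Properties using (lookup-injective)
open import Data.Product using (∃; _×_; _,_; proj₁; proj₂)
open import Data.Sum using (_⊎_; inj₁; inj₂)
open import Data.Empty using (⊥; ⊥-elim)
open import Relation.Nullary using (¬_; yes; no)
open import Relation.Nullary.Decidable using (True; toWitness; isYes≗does; dec-true)
open import Relation.Binary using (Rel)
open import Relation.Binary.PropositionalEquality using (_≡_; _≢_; refl; trans; subst; ≢-sym)
  renaming (sym to ≡-sym)

∣p∪q∣≤∣p∣+∣q∣ : ∀ {n} (p q : Subset n) → ∣ p ∪ q ∣ ≤ ∣ p ∣ + ∣ q ∣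
∣p∪q∣≤∣p∣+∣q∣ []            []            = z≤n
∣p∪q∣≤∣p∣+∣q∣ (outside ∷ p) (outside ∷ q) = ∣p∪q∣≤∣p∣+∣q∣ p q
∣p∪q∣≤∣p∣+∣q∣ (inside  ∷ p) (outside ∷ q) = s≤s (∣p∪q∣≤∣p∣+∣q∣ p q)
∣p∪q∣≤∣p∣+∣q∣ (outside ∷ p) (inside  ∷ q) =
  ≤-trans (s≤s (∣p∪q∣≤∣p∣+∣q∣ p q)) (≤-reflexive (≡-sym (+-suc ∣ p ∣ ∣ q ∣)))
∣p∪q∣≤∣p∣+∣q∣ (inside  ∷ p) (inside  ∷ q) =
  s≤s (≤-trans (∣p∪q∣≤∣p∣+∣q∣ p q) (+-monoʳ-≤ ∣ p ∣ (n≤1+n ∣ q ∣)))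

p∈ps⇒p⊆⋃ps : ∀ {n} {p : Subset n} {ps : List (Subset n)} → p ∈ₗ ps → p ⊆ ⋃ ps
p∈ps⇒p⊆⋃ps {ps = q ∷ qs} (here refl)  = p⊆p∪q (⋃ qs)
p∈ps⇒p⊆⋃ps {ps = q ∷ qs} (there p∈qs) = λ x∈p → q⊆p∪q q (⋃ qs) (p∈ps⇒p⊆⋃ps p∈qs x∈p)

∣⋃ps∣≤length : ∀ {n} {ps : List (Subset n)} → All (λ p → ∣ p ∣ ≤ 1) ps → ∣ ⋃ ps ∣ ≤ length ps
∣⋃ps∣≤length {n} []                = ≤-reflexive (∣⊥∣≡0 n)
∣⋃ps∣≤length {ps = p ∷ ps} (∣p∣≤1 ∷ ∣ps∣≤1) =
  ≤-trans (∣p∪q∣≤∣p∣+∣q∣ p (⋃ ps)) (+-mono-≤ ∣p∣≤1 (∣⋃ps∣≤length ∣ps∣≤1))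

all⊎any : ∀ {n p q} {P : Fin n → Set p} {Q : Fin n → Set q} →
          (∀ i → P i ⊎ Q i) → (∀ i → P i) ⊎ ∃ Q
all⊎any {zero}  P⊎Q = inj₁ λ ()
all⊎any {suc n} P⊎Q with P⊎Q zero | all⊎any (λ i → P⊎Q (suc i))
... | inj₂ Q₀ | _         = inj₂ (zero , Q₀)
... | inj₁ P₀ | inj₁ Pₛ   = inj₁ (∀-cons P₀ Pₛ)
... | inj₁ _  | inj₂ ∃Qₛ = inj₂ (∃-there ∃Qₛ)

module _ {a} {A : Set a} where

  lookup-fromℕ : ∀ {m} (xs : Vec A (suc m)) → lookup xs (fromℕ m) ≡ last xs
  lookup-fromℕ (x ∷ [])     = refl
  lookup-fromℕ (x ∷ y ∷ ys) = lookup-fromℕ (y ∷ ys)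

  Linked⇒lookup-suc : ∀ {ℓ} {R : Rel A ℓ} {m} {xs : Vec A (suc m)} → Linked R xs →
                      ∀ (i : Fin m) → R (lookup xs (inject₁ i)) (lookup xs (suc i))
  Linked⇒lookup-suc {xs = x ∷ y ∷ ys} (Rxy ∷ _)   zero    = Rxy
  Linked⇒lookup-suc {xs = x ∷ y ∷ ys} (_   ∷ Rys) (suc i) = Linked⇒lookup-suc Rys i

adj⇒≢ : ∀ {n} (G : Graph n) {u v} → Adj G u v → u ≢ v
adj⇒≢ G uv refl = irrefl G uv

isCycle-lookup : ∀ {n} (G : Graph n) {m} (xs : Vec (Fin n) (suc m)) → 3 ≤ suc m → Unique xs →
                 Linked (Adj G) xs → Adj G (last xs) (head xs) → IsCycle G m (lookup xs)
isCycle-lookup G xs@(x ∷ _) 3≤len distinct path closing =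
  3≤len , (λ {i} {j} → lookup-injective distinct i j) , Linked⇒lookup-suc path ,
  subst (λ y → Adj G y x) (≡-sym (lookup-fromℕ xs)) closing

module Neighbourhood {n} (G : Graph n) where

  data Dist≤2 (u : Fin n) : Fin n → Set where
    dist0 : Dist≤2 u u
    dist1 : ∀ {v} → Adj G u v → Dist≤2 u v
    dist2 : ∀ {v w} → Adj G u w → Adj G w v → Dist≤2 u v

  Is2Clique : Subset n → Set
  Is2Clique M = ∀ {u v} → u ∈ M → v ∈ M → Dist≤2 u v

  _∈N[_] : Fin n → Fin n → Set
  v ∈N[ x ] = v ≡ x ⊎ Adj G x v

  Dominates : Subset n → Subset n → Set
  Dominates D M = ∀ {v} → v ∈ M → v ∈ D ⊎ ∃ λ u → u ∈ D × Adj G u v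

  is2DMV⇒is2Clique : ∀ {M} → Is2DMV G M → Is2Clique M
  is2DMV⇒is2Clique visible {u} {v} u∈M v∈M with u ≟ v
  ... | yes refl = dist0
  ... | no u≢v with visible u v u∈M v∈M u≢v
  ...   | inj₁ uv                        = dist1 uv
  ...   | inj₂ (_ , _ , _ , uw , wv , _) = dist2 uw wv

  dominates-mono : ∀ {D D′ M} → D ⊆ D′ → Dominates D M → Dominates D′ M
  dominates-mono D⊆D′ D↠M v∈M with D↠M v∈M
  ... | inj₁ v∈D           = inj₁ (D⊆D′ v∈D)
  ... | inj₂ (u , u∈D , uv) = inj₂ (u , D⊆D′ u∈D , uv)

  ⊆N[x]⇒⁅x⁆-dominates : ∀ {M x} → (∀ {v} → v ∈ M → v ∈N[ x ]) → Dominates ⁅ x ⁆ M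
  ⊆N[x]⇒⁅x⁆-dominates {x = x} M⊆N[x] v∈M with M⊆N[x] v∈M
  ... | inj₁ refl = inj₁ (x∈⁅x⁆ x)
  ... | inj₂ xv   = inj₂ (x , x∈⁅x⁆ x , xv)

  empty⇒∅-dominates : ∀ {M} → Empty M → Dominates ∅ M
  empty⇒∅-dominates M-empty v∈M = ⊥-elim (M-empty (_ , v∈M))

  ∈N[u]⊎twoStepsFrom-u : ∀ {M u} → Is2Clique M → u ∈ M →
    ∀ v → (v ∈ M → v ∈N[ u ]) ⊎ (v ∈ M × u ≢ v × ∃ λ w → Adj G u w × Adj G w v)
  ∈N[u]⊎twoStepsFrom-u {M} {u} clique u∈M v with v ∈? M
  ... | no v∉M = inj₁ λ v∈M → ⊥-elim (v∉M v∈M)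
  ... | yes v∈M with clique u∈M v∈M
  ...   | dist0    = inj₁ λ _ → inj₁ refl
  ...   | dist1 uv = inj₁ λ _ → inj₂ uv
  ...   | dist2 {w = w} uw wv with u ≟ v
  ...     | yes refl = inj₁ λ _ → inj₁ refl
  ...     | no u≢v   = inj₂ (v∈M , u≢v , w , uw , wv)

module Girth≥7 {n} (G : Graph n) (girth : GirthAtLeast7 G) where

  open Neighbourhood G

  noShortCycle : ∀ {m} (xs : Vec (Fin n) (suc m)) {_ : True (3 ≤? suc m)} {_ : True (suc m <? 7)} →
                 Unique xs → Linked (Adj G) xs → Adj G (last xs) (head xs) → ⊥
  noShortCycle {m} xs {3≤len} {len<7} distinct path closing =
    <⇒≱ (toWitness len<7)
        (girth m (lookup xs) (isCycle-lookup G xs (toWitness 3≤len) distinct path closing))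

  noTriangle : ∀ {u v w} → Adj G u v → Adj G v w → ¬ Adj G w u
  noTriangle uv vw wu = noShortCycle (_ ∷ _ ∷ _ ∷ [])
    ((adj⇒≢ G uv ∷ ≢-sym (adj⇒≢ G wu) ∷ []) ∷ (adj⇒≢ G vw ∷ []) ∷ [] ∷ [])
    (uv ∷ vw ∷ [-]) wu

  commonNeighbour-unique : ∀ {u v a b} → u ≢ v →
                           Adj G u a → Adj G a v → Adj G u b → Adj G b v → a ≡ b
  commonNeighbour-unique {a = a} {b} u≢v ua av ub bv with a ≟ b
  ... | yes a≡b = a≡b
  ... | no a≢b  = ⊥-elim (noShortCycle (_ ∷ _ ∷ _ ∷ _ ∷ [])
    ( (adj⇒≢ G ua ∷ u≢v ∷ adj⇒≢ G ub ∷ [])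
    ∷ (adj⇒≢ G av ∷ a≢b ∷ [])
    ∷ (≢-sym (adj⇒≢ G bv) ∷ [])
    ∷ [] ∷ [])
    (ua ∷ av ∷ sym G bv ∷ [-]) (sym G ub))

  module CommonNeighbour {u v₀ w} (u≢v₀ : u ≢ v₀) (uw : Adj G u w) (wv₀ : Adj G w v₀) where

    u≁v₀ : ¬ Adj G u v₀
    u≁v₀ uv₀ = noTriangle uw wv₀ (sym G uv₀)

    u≢v₀-neighbour : ∀ {b} → Adj G v₀ b → u ≢ b
    u≢v₀-neighbour v₀b refl = u≁v₀ (sym G v₀b)

    u-neighbour≢v₀ : ∀ {a} → Adj G u a → a ≢ v₀
    u-neighbour≢v₀ ua refl = u≁v₀ ua

    module _ {v} (v≢u : v ≢ u) (v≢v₀ : v ≢ v₀) (v≢w : v ≢ w) where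

      ¬edge-path : ∀ {b} → Adj G u v → Adj G v₀ b → Adj G b v → ⊥
      ¬edge-path {b} uv v₀b bv with b ≟ w
      ... | yes refl = noTriangle uv (sym G bv) (sym G uw)
      ... | no b≢w   = noShortCycle (u ∷ v ∷ b ∷ v₀ ∷ w ∷ [])
        ( (≢-sym v≢u ∷ u≢v₀-neighbour v₀b ∷ u≢v₀ ∷ adj⇒≢ G uw ∷ [])
        ∷ (≢-sym (adj⇒≢ G bv) ∷ v≢v₀ ∷ v≢w ∷ [])
        ∷ (≢-sym (adj⇒≢ G v₀b) ∷ b≢w ∷ [])
        ∷ (≢-sym (adj⇒≢ G wv₀) ∷ [])
        ∷ [] ∷ [])
        (uv ∷ sym G bv ∷ sym G v₀b ∷ sym G wv₀ ∷ [-]) (sym G uw)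

      path-path⇒adj : ∀ {a b} → Adj G u a → Adj G a v → Adj G v₀ b → Adj G b v → Adj G w v
      path-path⇒adj {a} {b} ua av v₀b bv with a ≟ w | b ≟ w | a ≟ b
      ... | yes refl | _        | _        = av
      ... | no _     | yes refl | _        = bv
      ... | no _     | no _     | yes refl =
        subst (λ x → Adj G x v) (commonNeighbour-unique u≢v₀ ua (sym G v₀b) uw wv₀) av
      ... | no a≢w   | no b≢w   | no a≢b   = ⊥-elim (noShortCycle (u ∷ a ∷ v ∷ b ∷ v₀ ∷ w ∷ [])
        ( (adj⇒≢ G ua ∷ ≢-sym v≢u ∷ u≢v₀-neighbour v₀b ∷ u≢v₀ ∷ adj⇒≢ G uw ∷ [])
        ∷ (adj⇒≢ G av ∷ a≢b ∷ u-neighbour≢v₀ ua ∷ a≢w ∷ [])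
        ∷ (≢-sym (adj⇒≢ G bv) ∷ v≢v₀ ∷ v≢w ∷ [])
        ∷ (≢-sym (adj⇒≢ G v₀b) ∷ b≢w ∷ [])
        ∷ (≢-sym (adj⇒≢ G wv₀) ∷ [])
        ∷ [] ∷ [])
        (ua ∷ av ∷ sym G bv ∷ sym G v₀b ∷ sym G wv₀ ∷ [-]) (sym G uw))

  dist≤2⇒adj-commonNeighbour : ∀ {u v₀ w v} → u ≢ v₀ → Adj G u w → Adj G w v₀ →
                               v ≢ u → v ≢ v₀ → v ≢ w → Dist≤2 u v → Dist≤2 v₀ v → Adj G w v
  dist≤2⇒adj-commonNeighbour u≢v₀ uw wv₀ v≢u v≢v₀ v≢w = λ where
      dist0         _              → ⊥-elim (v≢u refl)
      _             dist0          → ⊥-elim (v≢v₀ refl)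
      (dist1 uv)    (dist1 v₀v)    → ⊥-elim (v≢w (commonNeighbour-unique u≢v₀ uv (sym G v₀v) uw wv₀))
      (dist1 uv)    (dist2 v₀b bv) → ⊥-elim (¬edge-path v≢u v≢v₀ v≢w uv v₀b bv)
      (dist2 ua av) (dist1 v₀v)    → ⊥-elim (V₀U.¬edge-path v≢v₀ v≢u v≢w v₀v ua av)
      (dist2 ua av) (dist2 v₀b bv) → path-path⇒adj v≢u v≢v₀ v≢w ua av v₀b bv
    where
    open CommonNeighbour u≢v₀ uw wv₀
    module V₀U = CommonNeighbour (≢-sym u≢v₀) (sym G wv₀) (sym G uw)

  dist≤2⇒∈N[commonNeighbour] : ∀ {u v₀ w v} → u ≢ v₀ → Adj G u w → Adj G w v₀ →
                               Dist≤2 u v → Dist≤2 v₀ v → v ∈N[ w ]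
  dist≤2⇒∈N[commonNeighbour] {u} {v₀} {w} {v} u≢v₀ uw wv₀ uv v₀v with v ≟ w | v ≟ u | v ≟ v₀
  ... | yes v≡w | _        | _        = inj₁ v≡w
  ... | no _    | yes refl | _        = inj₂ (sym G uw)
  ... | no _    | no _     | yes refl = inj₂ wv₀
  ... | no v≢w  | no v≢u   | no v≢v₀  =
    inj₂ (dist≤2⇒adj-commonNeighbour u≢v₀ uw wv₀ v≢u v≢v₀ v≢w uv v₀v)

  is2Clique⇒⊆N[x] : ∀ {M} → Is2Clique M → Empty M ⊎ ∃ λ x → ∀ {v} → v ∈ M → v ∈N[ x ]
  is2Clique⇒⊆N[x] {M} clique with nonempty? M
  ... | no M-empty = inj₁ M-empty
  ... | yes (u , u∈M) with all⊎any (∈N[u]⊎twoStepsFrom-u clique u∈M)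
  ...   | inj₁ M⊆N[u] = inj₂ (u , λ {v} → M⊆N[u] v)
  ...   | inj₂ (v₀ , v₀∈M , u≢v₀ , w , uw , wv₀) =
    inj₂ (w , λ v∈M → dist≤2⇒∈N[commonNeighbour] u≢v₀ uw wv₀ (clique u∈M v∈M) (clique v₀∈M v∈M))

  is2Clique⇒dominatedBy≤1 : ∀ {M} → Is2Clique M → ∃ λ D → ∣ D ∣ ≤ 1 × Dominates D M
  is2Clique⇒dominatedBy≤1 clique with is2Clique⇒⊆N[x] clique
  ... | inj₁ M-empty      = ∅ , ≤-trans (≤-reflexive (∣⊥∣≡0 n)) z≤n , empty⇒∅-dominates M-empty
  ... | inj₂ (x , M⊆N[x]) = ⁅ x ⁆ , ≤-reflexive (∣⁅x⁆∣≡1 x) , ⊆N[x]⇒⁅x⁆-dominates M⊆N[x]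

∈-colourClass : ∀ {n k} (G : Graph n) (c : Fin n → Fin k) v → v ∈ _⁻¹[_] G c (c v)
∈-colourClass G c v =
  lookup⇒[]= v _ (trans (lookup∘tabulate _ v)
                        (trans (isYes≗does (c v ≟ c v)) (dec-true (c v ≟ c v) refl)))

theorem3p4 : ∀ {n : ℕ} (G : Graph n) → GirthAtLeast7 G →
    ∀ (k : ℕ) → Has2DMVPartition G k → DominationAtMost G k
theorem3p4 {n} G girth k (c , visible) = D , dominating , ∣D∣≤k
  where
  open Neighbourhood G
  open Girth≥7 G girth

  dominator : ∀ i → ∃ λ D → ∣ D ∣ ≤ 1 × Dominates D (_⁻¹[_] G c i)
  dominator i = is2Clique⇒dominatedBy≤1 (is2DMV⇒is2Clique (visible i))

  D : Subset n
  D = ⋃ (tabulate (λ i → proj₁ (dominator i)))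

  dominating : IsDominating G D
  dominating v = dominates-mono (p∈ps⇒p⊆⋃ps (∈-tabulate⁺ (c v))) (proj₂ (proj₂ (dominator (c v))))
                                (∈-colourClass G c v)

  ∣D∣≤k : ∣ D ∣ ≤ k
  ∣D∣≤k = subst (∣ D ∣ ≤_) (length-tabulate _)
                (∣⋃ps∣≤length (tabulate⁺ (λ i → proj₁ (proj₂ (dominator i)))))
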